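{- Let $q$ be a prime power, $m,n$ positive integers, and $\alpha\in\mathbb{F}_{q^{mn}}$ with $\mathbb{F}_{q^{mn}}=\mathbb{F}_q(\alpha)$. Let $\mathfrak{S}_\alpha$ be the set of $m$-dimensional $\alpha$-splitting subspaces of $\mathbb{F}_{q^{mn}}$ and, for $x\in\mathbb{F}_{q^{mn}}$, let $\mathfrak{S}_\alpha^x=\{W\in\mathfrak{S}_\alpha: x\in W\}$. Then: (i) $\mathfrak{S}_\alpha$ is nonempty, and if $W\in\mathfrak{S}_\alpha$ and $\beta\in\mathbb{F}_{q^{mn}}^*$ then $\beta W\in\mathfrak{S}_\alpha$; (ii) $\mathfrak{S}_\alpha^x$ is nonempty for every $x\in\mathbb{F}_{q^{mn}}^*$; (iii) $|\mathfrak{S}_\alpha^x|=|\mathfrak{S}_\alpha^y|$ for all $x,y\in\mathbb{F}_{q^{mn}}^*$; (iv) $|\mathfrak{S}_\alpha|=|\mathfrak{S}_\alpha^x|\,(q^{mn}-1)/(q^m-1)$ for every $x\in\mathbb{F}_{q^{mn}}^*$.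
   Context: For $\sigma\in\mathbb{F}_{q^{mn}}$, an $m$-dimensional $\mathbb{F}_q$-linear subspace $W$ of $\mathbb{F}_{q^{mn}}$ is called $\sigma$-splitting if $\mathbb{F}_{q^{mn}}=W\oplus\sigma W\oplus\cdots\oplus\sigma^{n-1}W$. -}

module Defs where

open import Level using (0ℓ)
open import Data.Nat using (ℕ; zero; suc; _≤_)
open import Data.Nat.Primality using (Prime)
open import Data.Fin using (Fin)
open import Data.Fin.Subset using (Subset; _∈_)
open import Data.List using (List; length)
open import Data.List.Relation.Unary.Unique.Propositional using (Unique)
import Data.List.Membership.Propositional as ListMem
open import Data.Product using (Σ; Σ-syntax; ∃; ∃-syntax; _×_)
open import Relation.Nullary using (¬_)
open import Relation.Binary.PropositionalEquality using (_≡_)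
open import Function.Bundles using (_↔_; _⇔_)
open import Algebra.Structures using (IsCommutativeRing)

IsPrimePower : ℕ → Set
IsPrimePower q = ∃[ p ] ∃[ k ] (Prime p × 1 ≤ k × q ≡ p Data.Nat.^ k)

-- |{ a : A | P a }| = k : an explicit duplicate-free list of length k
-- enumerating exactly the elements satisfying P.
HasCard : {A : Set} → (A → Set) → ℕ → Set
HasCard {A} P k = Σ (List A) λ xs →
  length xs ≡ k × Unique xs × (∀ a → P a ⇔ (a ListMem.∈ xs))

record FiniteField (N : ℕ) : Set₁ where
  infixl 7 _*_
  infixl 6 _+_
  field
    Carrier : Set
    _+_ _*_ : Carrier → Carrier → Carrier
    -_ : Carrier → Carrier
    0# 1# : Carrier
    isCommutativeRing : IsCommutativeRing _≡_ _+_ _*_ -_ 0# 1#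
    0≢1 : ¬ (0# ≡ 1#)
    inverse : ∀ x → ¬ (x ≡ 0#) → ∃[ y ] (x * y ≡ 1#)
    enumeration : Carrier ↔ Fin N

module FieldNotions {N : ℕ} (K : FiniteField N) where
  open FiniteField K
  open Function.Bundles.Inverse enumeration using (to)

  _^_ : Carrier → ℕ → Carrier
  x ^ zero = 1#
  x ^ suc k = x * (x ^ k)

  ∑ : (k : ℕ) → (Fin k → Carrier) → Carrier
  ∑ zero f = 0#
  ∑ (suc k) f = f Data.Fin.zero + ∑ k (λ i → f (Data.Fin.suc i))

  record IsSubfield (S : Carrier → Set) : Set where
    field
      has-0 : S 0#
      has-1 : S 1#
      closed-+ : ∀ {x y} → S x → S y → S (x + y)
      closed-neg : ∀ {x} → S x → S (- x)
      closed-* : ∀ {x y} → S x → S y → S (x * y)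
      closed-inv : ∀ {x y} → S x → x * y ≡ 1# → S y

  -- K = F(α): the only subfield of K containing F and α is K itself
  Generates : (F : Carrier → Set) → Carrier → Set₁
  Generates F α = ∀ (S : Carrier → Set) → IsSubfield S →
    (∀ c → F c → S c) → S α → ∀ x → S x

  -- subsets of K, encoded via the enumeration K ↔ Fin N
  _∈K_ : Carrier → Subset N → Set
  x ∈K W = to x ∈ W

  module OverSubfield (F : Carrier → Set) where

    record IsSubspace (W : Subset N) : Set where
      field
        has-0 : 0# ∈K W
        closed-+ : ∀ {x y} → x ∈K W → y ∈K W → (x + y) ∈K W
        closed-scalar : ∀ {c x} → F c → x ∈K W → (c * x) ∈K W

    HasDimension : ℕ → Subset N → Set
    HasDimension m W = Σ[ b ∈ (Fin m → Carrier) ] ((∀ (i : Fin m) → b i ∈K W)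
      × (∀ w → w ∈K W → Σ[ c ∈ (Fin m → Carrier) ] ((∀ i → F (c i)) × w ≡ ∑ m (λ i → c i * b i)))
      × (∀ (c : Fin m → Carrier) → (∀ i → F (c i)) → ∑ m (λ i → c i * b i) ≡ 0# → ∀ i → c i ≡ 0#))

    -- K = W ⊕ σW ⊕ ⋯ ⊕ σ^{n-1}W (internal direct sum)
    IsSplitting : ℕ → Carrier → Subset N → Set
    IsSplitting n σ W =
      (∀ x → Σ[ w ∈ (Fin n → Carrier) ] ((∀ (i : Fin n) → w i ∈K W)
                     × x ≡ ∑ n (λ i → (σ ^ Data.Fin.toℕ i) * w i)))
      × (∀ (w w' : Fin n → Carrier) → (∀ i → w i ∈K W) → (∀ i → w' i ∈K W)
           → ∑ n (λ i → (σ ^ Data.Fin.toℕ i) * w i)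
             ≡ ∑ n (λ i → (σ ^ Data.Fin.toℕ i) * w' i)
           → ∀ i → w i ≡ w' i)

    IsSplittingSubspace : ℕ → ℕ → Carrier → Subset N → Set
    IsSplittingSubspace m n σ W =
      IsSubspace W × HasDimension m W × IsSplitting n σ W

    IsSplittingSubspaceThrough : ℕ → ℕ → Carrier → Carrier → Subset N → Set
    IsSplittingSubspaceThrough m n σ x W = IsSplittingSubspace m n σ W × x ∈K W

module Submission where

-- (a) Degree.  Let d be the first index at which 1, α, …, α^d become F-dependent.
--     Then α^d lies in S = span{1, …, α^(d-1)}, so S is closed under multiplication,
--     and since inverses in a finite field are powers, S is a subfield containing F
--     and α; hence S = K.  Counting, q^d = |K| = q^(mn), so 1, α, …, α^(mn-1) is a basis.
-- (b) A splitting subspace.  Writing exponents t < mn as t = nj + i (i < n, j < m),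
--     W₀ = span{α^(nj) : j < m} satisfies K = W₀ ⊕ αW₀ ⊕ ⋯ ⊕ α^(n-1)W₀, and 1 ∈ W₀.
-- (c) Scaling.  W ↦ βW (β ≠ 0) preserves m-dimensional α-splitting subspaces: this is
--     (i), and applied to W₀ ∋ 1 it gives (ii).  For nonzero x, y the map W ↦ (y/x)W
--     is a bijection 𝔖^x → 𝔖^y, which gives (iii).
-- (d) Counting.  Being a splitting subspace is decidable, so 𝔖 and 𝔖^x are enumerated
--     by filtering the list of all subsets of K.  Double counting the pairs (W, z) with
--     0 ≠ z ∈ W ∈ 𝔖 gives |𝔖| (q^m - 1) = |𝔖^x| (q^(mn) - 1), which is (iv).

open import Defs
open import Level using (0ℓ)
open import Data.Nat as ℕ using (ℕ; zero; suc; _≤_; z≤n; s≤s)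
import Data.Nat.Properties as ℕ
open import Data.Nat.ListAction using (sum)
open import Data.Nat.Primality using (prime⇒nonTrivial; prime⇒nonZero)
open import Data.Fin as Fin using (Fin; toℕ; _↑ˡ_; _↑ʳ_; combine; quotient; remainder; inject₁; fromℕ)
import Data.Fin.Properties as Fin
open import Data.Fin.Subset using (Subset)
import Data.Fin.Subset.Properties as Subset
open import Data.Bool using (Bool; true; false; if_then_else_)
open import Data.Unit using (⊤; tt)
open import Data.Empty using (⊥-elim)
open import Data.Product using (Σ-syntax; ∃; ∃-syntax; _×_; _,_; proj₁; proj₂)
open import Data.List using (List; []; _∷_; length; map; filter; cartesianProductWith; allFin)
open import Data.List.Properties using (length-map; length-++; length-tabulate; map-cong)
open import Data.List.Membership.Propositional using (_∈_)
open import Data.List.Membership.Propositional.Properties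
  using (∈-map⁺; ∈-map⁻; ∈-filter⁺; ∈-filter⁻; ∈-allFin; ∈-cartesianProductWith⁺; ∈-cartesianProductWith⁻)
open import Data.List.Membership.DecPropositional using (_∈?_)
open import Data.List.Relation.Unary.Any using (here; there)
import Data.List.Relation.Unary.All as All
import Data.List.Relation.Unary.AllPairs as AllPairs
open import Data.List.Relation.Unary.Unique.Propositional using (Unique)
import Data.List.Relation.Unary.Unique.Propositional.Properties as Unique
open import Data.Vec using (Vec; []; _∷_; lookup; tabulate)
open import Data.Vec.Properties
  using (∷-injective; lookup∘tabulate; tabulate∘lookup; tabulate-cong; []=⇒lookup; lookup⇒[]=)
import Data.Vec.Functional as Vector
import Data.Vec.Relation.Unary.All as VecAll
import Data.Vec.Relation.Unary.All.Properties as VecAll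
open import Relation.Nullary using (¬_; Dec; yes; no; ¬?; does; _×-dec_; _→-dec_)
open import Relation.Nullary.Decidable using (map′; decidable-stable)
open import Relation.Unary using (Decidable)
open import Relation.Binary.Definitions using (DecidableEquality; tri<; tri≈; tri>)
open import Relation.Binary.PropositionalEquality
  using (_≡_; refl; sym; trans; cong; cong₂; subst; module ≡-Reasoning)
open import Function.Base using (id; _∘_)
open import Function.Bundles using (_⇔_; mk⇔; Equivalence; Inverse)
open import Algebra.Bundles using (CommutativeRing)
import Algebra.Properties.Ring as RingProperties
import Algebra.Properties.Semiring.Sum as SumProperties

module Counting where
  open import Data.Nat using (_+_; _*_; _^_; _∸_)
  open import Data.Nat.Properties using (+-commutativeSemigroup)
  open import Algebra.Properties.CommutativeSemigroup +-commutativeSemigroup using (interchange)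
  open Equivalence using (to; from)

  module _ {A : Set} where

    -- A duplicate-free list contained in ys is at most as long as ys; the proof
    -- deletes the image of the head from ys and recurses.
    unique-⊆⇒length-≤ : {xs ys : List A} → Unique xs → (∀ {z} → z ∈ xs → z ∈ ys) →
                        length xs ≤ length ys
    unique-⊆⇒length-≤ {[]} _ _ = z≤n
    unique-⊆⇒length-≤ {x ∷ xs} {ys} (x∉xs AllPairs.∷ u) xs⊆ys =
      subst (suc (length xs) ≤_) (length-remove ys x∈ys)
        (s≤s (unique-⊆⇒length-≤ u (λ z∈xs → ∈-remove ys x∈ys (xs⊆ys (there z∈xs)) (≢x z∈xs))))
      where
      x∈ys : x ∈ ys
      x∈ys = xs⊆ys (here refl)
      ≢x : ∀ {z} → z ∈ xs → ¬ z ≡ x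
      ≢x z∈xs refl = All.lookup x∉xs z∈xs refl
      remove : ∀ {y} (ys : List A) → y ∈ ys → List A
      remove (_ ∷ ys) (here _) = ys
      remove (y ∷ ys) (there p) = y ∷ remove ys p
      length-remove : ∀ {y} (ys : List A) (p : y ∈ ys) → suc (length (remove ys p)) ≡ length ys
      length-remove (_ ∷ ys) (here _) = refl
      length-remove (_ ∷ ys) (there p) = cong suc (length-remove ys p)
      ∈-remove : ∀ {y z} (ys : List A) (p : y ∈ ys) → z ∈ ys → ¬ z ≡ y → z ∈ remove ys p
      ∈-remove (_ ∷ ys) (here refl) (here refl) z≢y = ⊥-elim (z≢y refl)
      ∈-remove (_ ∷ ys) (here refl) (there q) _ = q
      ∈-remove (_ ∷ ys) (there p) (here refl) _ = here refl
      ∈-remove (_ ∷ ys) (there p) (there q) z≢y = there (∈-remove ys p q z≢y)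

    card-unique : {P Q : A → Set} {a b : ℕ} → HasCard P a → HasCard Q b →
                  (∀ x → P x ⇔ Q x) → a ≡ b
    card-unique (xs , refl , uxs , exs) (ys , refl , uys , eys) P⇔Q =
      ℕ.≤-antisym (unique-⊆⇒length-≤ uxs (λ {z} z∈xs → to (eys z) (to (P⇔Q z) (from (exs z) z∈xs))))
                (unique-⊆⇒length-≤ uys (λ {z} z∈ys → to (exs z) (from (P⇔Q z) (from (eys z) z∈ys))))

    HasCard-⇔ : {P Q : A → Set} {k : ℕ} → (∀ x → P x ⇔ Q x) → HasCard P k → HasCard Q k
    HasCard-⇔ P⇔Q (xs , len , u , e) =
      xs , len , u , λ x → mk⇔ (λ qx → to (e x) (from (P⇔Q x) qx)) (λ x∈xs → to (P⇔Q x) (from (e x) x∈xs))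

    HasCard-filter : {P R : A → Set} {k : ℕ} (c : HasCard P k) (R? : Decidable R) →
                     HasCard (λ x → P x × R x) (length (filter R? (proj₁ c)))
    HasCard-filter (xs , _ , u , e) R? =
      filter R? xs , refl , Unique.filter⁺ R? u ,
      λ x → mk⇔ (λ (px , rx) → ∈-filter⁺ R? (to (e x) px) rx)
                (λ x∈ → let (x∈xs , rx) = ∈-filter⁻ R? x∈ in from (e x) x∈xs , rx)

    HasCard-insert : DecidableEquality A → {P : A → Set} {j : ℕ} {a : A} → P a →
                     HasCard (λ x → P x × ¬ x ≡ a) j → HasCard P (suc j)
    HasCard-insert _≟_ {P} {a = a} pa (xs , refl , u , e) =
      a ∷ xs , refl , All.tabulate (λ z∈xs a≡z → proj₂ (from (e _) z∈xs) (sym a≡z)) AllPairs.∷ u ,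
      λ x → mk⇔ (member x) (λ { (here refl) → pa ; (there x∈xs) → proj₁ (from (e x) x∈xs) })
      where
      member : ∀ x → P x → x ∈ (a ∷ xs)
      member x px with x ≟ a
      ... | yes refl = here refl
      ... | no x≢a = there (to (e x) (px , x≢a))

    HasCard-remove : {P : A → Set} {k : ℕ} → DecidableEquality A → HasCard P k →
                     ∀ {a} → P a → HasCard (λ x → P x × ¬ x ≡ a) (k ∸ 1)
    HasCard-remove {P} _≟_ c {a} pa =
      subst (HasCard _) (cong (_∸ 1) (card-unique (HasCard-insert _≟_ pa rest) c (λ _ → mk⇔ id id))) rest
      where
      rest : HasCard (λ x → P x × ¬ x ≡ a) (length (filter (λ x → ¬? (x ≟ a)) (proj₁ c)))
      rest = HasCard-filter c (λ x → ¬? (x ≟ a))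

    HasCard-image : {B : Set} {P : A → Set} {k : ℕ} (f : A → B) →
                    (∀ {x y} → P x → P y → f x ≡ f y → x ≡ y) →
                    HasCard P k → HasCard (λ b → ∃[ a ] (P a × b ≡ f a)) k
    HasCard-image {B} {P} f f-inj (xs , len , u , e) =
      map f xs , trans (length-map f xs) len , map-unique xs (λ x∈ → from (e _) x∈) u ,
      λ b → mk⇔ (λ (a , pa , b≡fa) → subst (_∈ map f xs) (sym b≡fa) (∈-map⁺ f (to (e a) pa)))
                (λ b∈ → let (a , a∈xs , b≡fa) = ∈-map⁻ f b∈ in a , from (e a) a∈xs , b≡fa)
      where
      map-unique : ∀ ys → (∀ {y} → y ∈ ys → P y) → Unique ys → Unique (map f ys)
      map-unique [] _ _ = AllPairs.[]
      map-unique (y ∷ ys) P-ys (y∉ys AllPairs.∷ u) =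
        All.tabulate (λ fz∈ fy≡fz → let (z , z∈ys , fz≡) = ∈-map⁻ f fz∈ in
          All.lookup y∉ys z∈ys (f-inj (P-ys (here refl)) (P-ys (there z∈ys)) (trans fy≡fz fz≡)))
        AllPairs.∷ map-unique ys (λ y∈ → P-ys (there y∈)) u

    HasCard-vectors : {P : A → Set} {c : ℕ} → HasCard P c → ∀ k → HasCard (VecAll.All P {k}) (c ^ k)
    HasCard-vectors {P} (xs , refl , u , e) k = vectors k , length-vectors k , unique-vectors k , member k
      where
      vectors : ∀ k → List (Vec A k)
      vectors zero = [] ∷ []
      vectors (suc k) = cartesianProductWith _∷_ xs (vectors k)
      length-product : ∀ (ys : List A) {k} (zs : List (Vec A k)) →
                       length (cartesianProductWith _∷_ ys zs) ≡ length ys * length zs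
      length-product [] zs = refl
      length-product (y ∷ ys) zs =
        trans (length-++ (map (y ∷_) zs)) (cong₂ _+_ (length-map (y ∷_) zs) (length-product ys zs))
      length-vectors : ∀ k → length (vectors k) ≡ length xs ^ k
      length-vectors zero = refl
      length-vectors (suc k) = trans (length-product xs (vectors k)) (cong (length xs *_) (length-vectors k))
      unique-vectors : ∀ k → Unique (vectors k)
      unique-vectors zero = All.[] AllPairs.∷ AllPairs.[]
      unique-vectors (suc k) = Unique.cartesianProductWith⁺ _∷_ ∷-injective u (unique-vectors k)
      member : ∀ k (v : Vec A k) → VecAll.All P v ⇔ v ∈ vectors k
      member zero [] = mk⇔ (λ _ → here refl) (λ _ → VecAll.[])
      member (suc k) (a ∷ v) = mk⇔
        (λ { (pa VecAll.∷ pv) → ∈-cartesianProductWith⁺ _∷_ (to (e a) pa) (to (member k v) pv) })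
        (λ av∈ → entries (∈-cartesianProductWith⁻ _∷_ xs (vectors k) av∈))
        where
        entries : ∃[ b ] ∃[ w ] (b ∈ xs × w ∈ vectors k × a ∷ v ≡ b ∷ w) → VecAll.All P (a ∷ v)
        entries (_ , _ , a∈xs , v∈ , refl) = from (e a) a∈xs VecAll.∷ from (member k v) v∈

  χ : {X : Set} → Dec X → ℕ
  χ d = if does d then 1 else 0

  module _ {A : Set} where

    length-filter≡sum-χ : {R : A → Set} (R? : Decidable R) (xs : List A) →
                          length (filter R? xs) ≡ sum (map (λ x → χ (R? x)) xs)
    length-filter≡sum-χ R? [] = refl
    length-filter≡sum-χ R? (x ∷ xs) with does (R? x)
    ... | true = cong suc (length-filter≡sum-χ R? xs)
    ... | false = length-filter≡sum-χ R? xs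

    sum-const : (xs : List A) (f : A → ℕ) {c : ℕ} → (∀ {x} → x ∈ xs → f x ≡ c) →
                sum (map f xs) ≡ length xs * c
    sum-const [] f f≡c = refl
    sum-const (x ∷ xs) f f≡c = cong₂ _+_ (f≡c (here refl)) (sum-const xs f (λ x∈ → f≡c (there x∈)))

    sum-map-+ : (xs : List A) (f g : A → ℕ) →
                sum (map (λ x → f x + g x) xs) ≡ sum (map f xs) + sum (map g xs)
    sum-map-+ [] f g = refl
    sum-map-+ (x ∷ xs) f g =
      trans (cong (f x + g x +_) (sum-map-+ xs f g)) (interchange (f x) (g x) _ _)

  sum-swap : {A B : Set} (xs : List A) (ys : List B) (f : A → B → ℕ) →
             sum (map (λ x → sum (map (f x) ys)) xs) ≡ sum (map (λ y → sum (map (λ x → f x y) xs)) ys)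
  sum-swap [] ys f = sym (trans (sum-const ys (λ _ → 0) (λ _ → refl)) (ℕ.*-zeroʳ (length ys)))
  sum-swap (x ∷ xs) ys f =
    trans (cong (sum (map (f x) ys) +_) (sum-swap xs ys f))
          (sym (sum-map-+ ys (f x) (λ y → sum (map (λ x′ → f x′ y) xs))))

  double-count : {A B : Set} {P : A → Set} {Q : B → Set} {R : A → B → Set} {p q c d : ℕ} →
                 (∀ a b → Dec (R a b)) → HasCard P p → HasCard Q q →
                 (∀ a → P a → HasCard (λ b → Q b × R a b) c) →
                 (∀ b → Q b → HasCard (λ a → P a × R a b) d) →
                 p * c ≡ q * d
  double-count {A} {B} {R = R} {c = c} {d} R? cP@(as , refl , _ , eP) cQ@(bs , refl , _ , eQ) rows columns =
    begin
      length as * c                                          ≡⟨ sum-const as row row≡c ⟨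
      sum (map row as)                                       ≡⟨ cong sum (map-cong row≡sum as) ⟩
      sum (map (λ a → sum (map (λ b → χ (R? a b)) bs)) as)   ≡⟨ sum-swap as bs (λ a b → χ (R? a b)) ⟩
      sum (map (λ b → sum (map (λ a → χ (R? a b)) as)) bs)   ≡⟨ cong sum (map-cong column≡sum bs) ⟨
      sum (map column bs)                                    ≡⟨ sum-const bs column column≡d ⟩
      length bs * d                                          ∎
    where
    open ≡-Reasoning
    row : A → ℕ
    row a = length (filter (R? a) bs)
    column : B → ℕ
    column b = length (filter (λ a → R? a b) as)
    row≡sum : ∀ a → row a ≡ sum (map (λ b → χ (R? a b)) bs)
    row≡sum a = length-filter≡sum-χ (R? a) bs
    column≡sum : ∀ b → column b ≡ sum (map (λ a → χ (R? a b)) as)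
    column≡sum b = length-filter≡sum-χ (λ a → R? a b) as
    row≡c : ∀ {a} → a ∈ as → row a ≡ c
    row≡c {a} a∈ = card-unique (HasCard-filter cQ (R? a)) (rows a (from (eP a) a∈)) (λ _ → mk⇔ id id)
    column≡d : ∀ {b} → b ∈ bs → column b ≡ d
    column≡d {b} b∈ =
      card-unique (HasCard-filter cP (λ a → R? a b)) (columns b (from (eQ b) b∈)) (λ _ → mk⇔ id id)


open Counting

module FieldFacts {N : ℕ} (K : FiniteField N) where
  open FiniteField K
  open FieldNotions K
  open Inverse enumeration using (to; from; strictlyInverseˡ; strictlyInverseʳ)

  commutativeRing : CommutativeRing 0ℓ 0ℓ
  commutativeRing = record { isCommutativeRing = isCommutativeRing }

  open CommutativeRing commutativeRing public
    using (+-assoc; +-comm; +-identityˡ; +-identityʳ; -‿inverseʳ; *-assoc; *-comm;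
           *-identityˡ; *-identityʳ; distribˡ; distribʳ; zeroˡ; zeroʳ)
  open RingProperties (CommutativeRing.ring commutativeRing) public
    using (-‿distribˡ-*; -‿distribʳ-*; x∙y⁻¹≈ε⇒x≈y; -1*x≈-x; -0#≈0#; +-inverseʳ-unique)
  private
    module Sum = SumProperties (CommutativeRing.semiring commutativeRing)

  to-injective : ∀ {x y} → to x ≡ to y → x ≡ y
  to-injective {x} {y} e = trans (sym (strictlyInverseʳ x)) (trans (cong from e) (strictlyInverseʳ y))

  _≟_ : DecidableEquality Carrier
  x ≟ y = map′ to-injective (cong to) (to x Fin.≟ to y)

  elements : HasCard (λ (_ : Carrier) → ⊤) N
  elements = map from (allFin N) , trans (length-map from (allFin N)) (length-tabulate {n = N} id) ,
    Unique.map⁺ (λ {i} {j} e → trans (sym (strictlyInverseˡ i)) (trans (cong to e) (strictlyInverseˡ j)))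
                (Unique.allFin⁺ N) ,
    λ x → mk⇔ (λ _ → subst (_∈ _) (strictlyInverseʳ x) (∈-map⁺ from (∈-allFin (to x))))
              (λ _ → tt)

  *-cancelˡ : ∀ {a} x y → ¬ a ≡ 0# → a * x ≡ a * y → x ≡ y
  *-cancelˡ {a} x y a≢0 ax≡ay with inverse a a≢0
  ... | a⁻¹ , aa⁻¹ = begin
    x               ≡⟨ sym (*-identityˡ x) ⟩
    1# * x          ≡⟨ cong (_* x) (trans (sym aa⁻¹) (*-comm a a⁻¹)) ⟩
    (a⁻¹ * a) * x   ≡⟨ *-assoc a⁻¹ a x ⟩
    a⁻¹ * (a * x)   ≡⟨ cong (a⁻¹ *_) ax≡ay ⟩
    a⁻¹ * (a * y)   ≡⟨ *-assoc a⁻¹ a y ⟨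
    (a⁻¹ * a) * y   ≡⟨ cong (_* y) (trans (*-comm a⁻¹ a) aa⁻¹) ⟩
    1# * y          ≡⟨ *-identityˡ y ⟩
    y               ∎
    where open ≡-Reasoning

  inverse-cancel : ∀ {a a′} → a * a′ ≡ 1# → ∀ z → a * (a′ * z) ≡ z
  inverse-cancel {a} {a′} aa′≡1 z = trans (sym (*-assoc a a′ z)) (trans (cong (_* z) aa′≡1) (*-identityˡ z))

  invertible⇒≢0 : ∀ {x y} → x * y ≡ 1# → ¬ x ≡ 0#
  invertible⇒≢0 {y = y} xy≡1 refl = 0≢1 (trans (sym (zeroˡ y)) xy≡1)

  *-exchange : ∀ a b c → a * (b * c) ≡ b * (a * c)
  *-exchange a b c = trans (sym (*-assoc a b c)) (trans (cong (_* c) (*-comm a b)) (*-assoc b a c))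

  ^-+ : ∀ x a b → x ^ (a ℕ.+ b) ≡ x ^ a * x ^ b
  ^-+ x zero b = sym (*-identityˡ _)
  ^-+ x (suc a) b = trans (cong (x *_) (^-+ x a b)) (sym (*-assoc x _ _))

  ^-≢0 : ∀ {x} k → ¬ x ≡ 0# → ¬ x ^ k ≡ 0#
  ^-≢0 zero x≢0 = λ 1≡0 → 0≢1 (sym 1≡0)
  ^-≢0 {x} (suc k) x≢0 xxᵏ≡0 = ^-≢0 k x≢0 (*-cancelˡ _ 0# x≢0 (trans xxᵏ≡0 (sym (zeroʳ x))))

  -- In a finite field the inverse of x is a power of x: two of the powers
  -- x, x², …, x^(N+1) coincide, x^(a+1) = x^(a+1+e+1), and cancelling gives x · xᵉ = 1.
  inverse-is-power : ∀ {x y} → x * y ≡ 1# → ∃[ e ] y ≡ x ^ e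
  inverse-is-power {x} {y} xy≡1 with Fin.pigeonhole (ℕ.n<1+n N) (λ i → to (x ^ suc (toℕ i)))
  ... | i , j , i<j , xⁱ≡xʲ = e , (begin
    y                ≡⟨ sym (*-identityʳ y) ⟩
    y * 1#           ≡⟨ cong (y *_) (sym x·xᵉ≡1) ⟩
    y * (x * x ^ e)  ≡⟨ *-assoc y x _ ⟨
    (y * x) * x ^ e  ≡⟨ cong (_* x ^ e) (trans (*-comm y x) xy≡1) ⟩
    1# * x ^ e       ≡⟨ *-identityˡ _ ⟩
    x ^ e            ∎)
    where
    open ≡-Reasoning
    a e : ℕ
    a = toℕ i
    e = toℕ j ℕ.∸ suc a
    x·xᵉ≡1 : x * x ^ e ≡ 1#
    x·xᵉ≡1 = *-cancelˡ _ _ (^-≢0 (suc a) (invertible⇒≢0 xy≡1)) (begin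
      x ^ suc a * x ^ suc e   ≡⟨ ^-+ x (suc a) (suc e) ⟨
      x ^ (suc a ℕ.+ suc e)   ≡⟨ cong (x ^_) (trans (ℕ.+-suc (suc a) e) (cong suc (ℕ.m+[n∸m]≡n i<j))) ⟩
      x ^ suc (toℕ j)         ≡⟨ to-injective xⁱ≡xʲ ⟨
      x ^ suc a               ≡⟨ sym (*-identityʳ _) ⟩
      x ^ suc a * 1#          ∎)

  -- Defs' sum ∑ agrees with the library's sum over the additive monoid of K,
  -- which lets us reuse the library's summation lemmas.
  ∑≡sum : ∀ {k} (f : Fin k → Carrier) → ∑ k f ≡ Sum.sum f
  ∑≡sum {zero} f = refl
  ∑≡sum {suc k} f = cong (f Fin.zero +_) (∑≡sum (λ i → f (Fin.suc i)))

  ∑-cong : ∀ {k} {f g : Fin k → Carrier} → (∀ i → f i ≡ g i) → ∑ k f ≡ ∑ k g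
  ∑-cong {zero} f≗g = refl
  ∑-cong {suc k} f≗g = cong₂ _+_ (f≗g Fin.zero) (∑-cong (f≗g ∘ Fin.suc))

  ∑-zero : ∀ k → ∑ k (λ _ → 0#) ≡ 0#
  ∑-zero k = trans (∑≡sum (λ (_ : Fin k) → 0#)) (Sum.sum-replicate-zero k)

  ∑-distrib-+ : ∀ {k} (f g : Fin k → Carrier) → ∑ k (λ i → f i + g i) ≡ ∑ k f + ∑ k g
  ∑-distrib-+ f g =
    trans (∑≡sum (λ i → f i + g i)) (trans (Sum.∑-distrib-+ f g) (sym (cong₂ _+_ (∑≡sum f) (∑≡sum g))))

  ∑-distribˡ-* : ∀ {k} a (f : Fin k → Carrier) → a * ∑ k f ≡ ∑ k (λ i → a * f i)
  ∑-distribˡ-* a f = trans (cong (a *_) (∑≡sum f)) (trans (Sum.*-distribˡ-sum a f) (sym (∑≡sum (λ i → a * f i))))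

  ∑-swap : ∀ {m n} (f : Fin m → Fin n → Carrier) →
           ∑ m (λ j → ∑ n (f j)) ≡ ∑ n (λ i → ∑ m (λ j → f j i))
  ∑-swap f = begin
    ∑ _ (λ j → ∑ _ (f j))                 ≡⟨ ∑-cong (λ j → ∑≡sum (f j)) ⟩
    ∑ _ (λ j → Sum.sum (f j))             ≡⟨ ∑≡sum (λ j → Sum.sum (f j)) ⟩
    Sum.sum (λ j → Sum.sum (f j))         ≡⟨ Sum.∑-comm f ⟩
    Sum.sum (λ i → Sum.sum (λ j → f j i)) ≡⟨ ∑≡sum (λ i → Sum.sum (λ j → f j i)) ⟨
    ∑ _ (λ i → Sum.sum (λ j → f j i))     ≡⟨ ∑-cong (λ i → ∑≡sum (λ j → f j i)) ⟨
    ∑ _ (λ i → ∑ _ (λ j → f j i))         ∎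
    where open ≡-Reasoning

  ∑-++ : ∀ n {k} (f : Fin (n ℕ.+ k) → Carrier) →
         ∑ (n ℕ.+ k) f ≡ ∑ n (λ i → f (i ↑ˡ k)) + ∑ k (λ i → f (n ↑ʳ i))
  ∑-++ zero f = sym (+-identityˡ _)
  ∑-++ (suc n) f = trans (cong (f Fin.zero +_) (∑-++ n (f ∘ Fin.suc))) (sym (+-assoc _ _ _))

  ∑-combine : ∀ m {n} (f : Fin (m ℕ.* n) → Carrier) →
              ∑ (m ℕ.* n) f ≡ ∑ m (λ j → ∑ n (λ i → f (combine j i)))
  ∑-combine zero f = refl
  ∑-combine (suc m) {n} f =
    trans (∑-++ n f) (cong (∑ n (λ i → f (i ↑ˡ (m ℕ.* n))) +_) (∑-combine m (λ t → f (n ↑ʳ t))))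

  ∑-init-last : ∀ k (f : Fin (suc k) → Carrier) → ∑ (suc k) f ≡ ∑ k (λ i → f (inject₁ i)) + f (fromℕ k)
  ∑-init-last k f =
    trans (∑≡sum f) (trans (Sum.sum-init-last f) (cong (_+ f (fromℕ k)) (sym (∑≡sum (λ i → f (inject₁ i))))))

  infix 7 _·_
  _·_ : ∀ {k} → (Fin k → Carrier) → (Fin k → Carrier) → Carrier
  _·_ {k} c b = ∑ k (λ i → c i * b i)

  ·-congˡ : ∀ {k} {c c′ : Fin k → Carrier} (b : Fin k → Carrier) → (∀ i → c i ≡ c′ i) → c · b ≡ c′ · b
  ·-congˡ b c≗c′ = ∑-cong (λ i → cong (_* b i) (c≗c′ i))

  ·-congʳ : ∀ {k} (c : Fin k → Carrier) {b b′ : Fin k → Carrier} → (∀ i → b i ≡ b′ i) → c · b ≡ c · b′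
  ·-congʳ c b≗b′ = ∑-cong (λ i → cong (c i *_) (b≗b′ i))

  ·-comm : ∀ {k} (c b : Fin k → Carrier) → c · b ≡ b · c
  ·-comm c b = ∑-cong (λ i → *-comm (c i) (b i))

  ·-+ : ∀ {k} (c c′ b : Fin k → Carrier) → c · b + c′ · b ≡ (λ i → c i + c′ i) · b
  ·-+ c c′ b = trans (sym (∑-distrib-+ (λ i → c i * b i) (λ i → c′ i * b i)))
                     (∑-cong (λ i → sym (distribʳ (b i) (c i) (c′ i))))

  ·-scaleˡ : ∀ {k} a (c b : Fin k → Carrier) → a * (c · b) ≡ (λ i → a * c i) · b
  ·-scaleˡ a c b = trans (∑-distribˡ-* a (λ i → c i * b i)) (∑-cong (λ i → sym (*-assoc a (c i) (b i))))

  ·-scaleʳ : ∀ {k} a (c b : Fin k → Carrier) → a * (c · b) ≡ c · (λ i → a * b i)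
  ·-scaleʳ a c b = trans (∑-distribˡ-* a (λ i → c i * b i)) (∑-cong (λ i → *-exchange a (c i) (b i)))

  ·-zero : ∀ {k} (b : Fin k → Carrier) → (λ _ → 0#) · b ≡ 0#
  ·-zero {k} b = trans (∑-cong (λ i → zeroˡ (b i))) (∑-zero k)

  ·-sub : ∀ {k} (c c′ b : Fin k → Carrier) → c · b + - (c′ · b) ≡ (λ i → c i + - c′ i) · b
  ·-sub c c′ b = begin
    c · b + - (c′ · b)                   ≡⟨ cong (c · b +_) (trans (sym (-1*x≈-x _)) (·-scaleˡ (- 1#) c′ b)) ⟩
    c · b + (λ i → - 1# * c′ i) · b      ≡⟨ ·-+ c _ b ⟩
    (λ i → c i + - 1# * c′ i) · b        ≡⟨ ∑-cong (λ i → cong (λ z → (c i + z) * b i) (-1*x≈-x (c′ i))) ⟩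
    (λ i → c i + - c′ i) · b             ∎
    where open ≡-Reasoning

  ·-subʳ : ∀ {k} (c b b′ : Fin k → Carrier) → c · b + - (c · b′) ≡ c · (λ i → b i + - b′ i)
  ·-subʳ c b b′ = begin
    c · b + - (c · b′)             ≡⟨ cong₂ (λ u v → u + - v) (·-comm c b) (·-comm c b′) ⟩
    b · c + - (b′ · c)             ≡⟨ ·-sub b b′ c ⟩
    (λ i → b i + - b′ i) · c       ≡⟨ ·-comm _ c ⟩
    c · (λ i → b i + - b′ i)       ∎
    where open ≡-Reasoning

  -- The powers 1, σ, …, σ^(k-1); the sum in IsSplitting is (powers σ n) · w = Σᵢ σⁱ wᵢ.
  powers : Carrier → ∀ k → Fin k → Carrier
  powers σ k i = σ ^ toℕ i

  δ : ∀ {k} → Fin k → Fin k → Carrier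
  δ Fin.zero Fin.zero = 1#
  δ Fin.zero (Fin.suc _) = 0#
  δ (Fin.suc _) Fin.zero = 0#
  δ (Fin.suc t) (Fin.suc i) = δ t i

  δ-refl : ∀ {k} (i : Fin k) → δ i i ≡ 1#
  δ-refl Fin.zero = refl
  δ-refl (Fin.suc i) = δ-refl i

  δ-≢ : ∀ {k} (t i : Fin k) → ¬ t ≡ i → δ t i ≡ 0#
  δ-≢ Fin.zero Fin.zero t≢i = ⊥-elim (t≢i refl)
  δ-≢ Fin.zero (Fin.suc _) _ = refl
  δ-≢ (Fin.suc _) Fin.zero _ = refl
  δ-≢ (Fin.suc t) (Fin.suc i) t≢i = δ-≢ t i (t≢i ∘ cong Fin.suc)

  δ-· : ∀ {k} (i : Fin k) (b : Fin k → Carrier) → (λ t → δ t i) · b ≡ b i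
  δ-· {suc k} Fin.zero b = trans (cong₂ _+_ (*-identityˡ _) (·-zero (b ∘ Fin.suc))) (+-identityʳ _)
  δ-· {suc k} (Fin.suc i) b = trans (cong₂ _+_ (zeroˡ _) (δ-· i (b ∘ Fin.suc))) (+-identityˡ _)

module Decide {N : ℕ} (K : FiniteField N) where
  open FiniteField K
  open FieldNotions K
  open Inverse enumeration using (to; from; strictlyInverseˡ; strictlyInverseʳ)

  ∃? : {P : Carrier → Set} → Decidable P → Dec (∃ P)
  ∃? {P} P? = map′ (λ (i , p) → from i , p) (λ (x , p) → to x , subst P (sym (strictlyInverseʳ x)) p)
                   (Fin.any? (P? ∘ from))

  ∀? : {P : Carrier → Set} → Decidable P → Dec (∀ x → P x)
  ∀? {P} P? = map′ (λ all-i x → subst P (strictlyInverseʳ x) (all-i (to x))) (λ all-x i → all-x (from i))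
                   (Fin.all? (P? ∘ from))

  Extensional : ∀ {k} → ((Fin k → Carrier) → Set) → Set
  Extensional P = ∀ {f g} → (∀ i → f i ≡ g i) → P f → P g

  ∃-family? : ∀ k {P : (Fin k → Carrier) → Set} → Extensional P → Decidable P → Dec (∃ P)
  ∃-family? zero ext P? = map′ (λ p → Vector.[] , p) (λ (f , p) → ext (λ ()) p) (P? Vector.[])
  ∃-family? (suc k) {P} ext P? =
    map′ (λ (a , f , p) → (a Vector.∷ f) , p)
         (λ (f , p) → f Fin.zero , f ∘ Fin.suc , ext (λ { Fin.zero → refl ; (Fin.suc i) → refl }) p)
         (∃? (λ a → ∃-family? k (λ f≗g → ext (λ { Fin.zero → refl ; (Fin.suc i) → f≗g i }))
                                 (P? ∘ (a Vector.∷_))))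

  ∀-family? : ∀ k {P : (Fin k → Carrier) → Set} → Extensional P → Decidable P → Dec (∀ f → P f)
  ∀-family? k {P} ext P? =
    map′ (λ no-counterexample f → decidable-stable (P? f) (λ ¬pf → no-counterexample (f , ¬pf)))
         (λ all-f (f , ¬pf) → ¬pf (all-f f))
         (¬? (∃-family? k (λ f≗g ¬pf pg → ¬pf (ext (sym ∘ f≗g) pg)) (¬? ∘ P?)))

  _∈K?_ : ∀ x W → Dec (x ∈K W)
  x ∈K? W = to x Subset.∈? W

  ⟦_⟧ : {P : Carrier → Set} → Decidable P → Subset N
  ⟦ P? ⟧ = tabulate (λ i → does (P? (from i)))

  ∈⟦⟧ : {P : Carrier → Set} (P? : Decidable P) → ∀ x → x ∈K ⟦ P? ⟧ ⇔ P x
  ∈⟦⟧ {P} P? x = mk⇔ (λ x∈ → decided (trans (sym lookup-x) ([]=⇒lookup x∈)))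
                     (λ px → lookup⇒[]= (to x) _ (trans lookup-x (accepted px)))
    where
    lookup-x : lookup ⟦ P? ⟧ (to x) ≡ does (P? x)
    lookup-x = trans (lookup∘tabulate _ (to x)) (cong (does ∘ P?) (strictlyInverseʳ x))
    decided : does (P? x) ≡ true → P x
    decided d with P? x
    ... | yes px = px
    accepted : P x → does (P? x) ≡ true
    accepted px with P? x
    ... | yes _ = refl
    ... | no ¬px = ⊥-elim (¬px px)

  subset-ext : ∀ {V W} → (∀ x → x ∈K V ⇔ x ∈K W) → V ≡ W
  subset-ext {V} {W} V⇔W =
    trans (sym (tabulate∘lookup V)) (trans (tabulate-cong same-entry) (tabulate∘lookup W))
    where
    bool-ext : ∀ {b c : Bool} → (b ≡ true → c ≡ true) → (c ≡ true → b ≡ true) → b ≡ c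
    bool-ext {true} b⇒c _ = sym (b⇒c refl)
    bool-ext {false} {true} _ c⇒b = c⇒b refl
    bool-ext {false} {false} _ _ = refl
    same-entry : ∀ i → lookup V i ≡ lookup W i
    same-entry i = subst (λ j → lookup V j ≡ lookup W j) (strictlyInverseˡ i) (bool-ext
      (λ v → []=⇒lookup (Equivalence.to (V⇔W (from i)) (lookup⇒[]= _ V v)))
      (λ w → []=⇒lookup (Equivalence.from (V⇔W (from i)) (lookup⇒[]= _ W w))))


module Linear {N : ℕ} (K : FiniteField N) (F : FiniteField.Carrier K → Set)
              (F-subfield : FieldNotions.IsSubfield K F) {q : ℕ} (F-card : HasCard F q) where
  open FiniteField K
  open FieldNotions K
  open OverSubfield F
  open FieldFacts K
  open Decide K
  open IsSubfield F-subfield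
    renaming (has-0 to F-0; has-1 to F-1; closed-+ to F-+; closed-neg to F-neg; closed-* to F-*)

  F? : ∀ c → Dec (F c)
  F? c = map′ (Equivalence.from (proj₂ (proj₂ (proj₂ F-card)) c))
              (Equivalence.to (proj₂ (proj₂ (proj₂ F-card)) c))
              ((_≟_ ∈? c) (proj₁ F-card))

  Coefficients : ∀ {k} → (Fin k → Carrier) → Set
  Coefficients c = ∀ i → F (c i)

  Span : ∀ {k} → (Fin k → Carrier) → Carrier → Set
  Span {k} b x = Σ[ c ∈ (Fin k → Carrier) ] (Coefficients c × x ≡ c · b)

  Independent : ∀ {k} → (Fin k → Carrier) → Set
  Independent {k} b = ∀ (c : Fin k → Carrier) → Coefficients c → c · b ≡ 0# → ∀ i → c i ≡ 0#

  Dependent : ∀ {k} → (Fin k → Carrier) → Set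
  Dependent {k} b = Σ[ c ∈ (Fin k → Carrier) ] (Coefficients c × c · b ≡ 0# × ∃[ i ] ¬ c i ≡ 0#)

  ¬dependent⇒independent : ∀ {k} (b : Fin k → Carrier) → ¬ Dependent b → Independent b
  ¬dependent⇒independent _ ¬dep c c-F c·b≡0 i with c i ≟ 0#
  ... | yes cᵢ≡0 = cᵢ≡0
  ... | no cᵢ≢0 = ⊥-elim (¬dep (c , c-F , c·b≡0 , i , cᵢ≢0))

  independent⇒injective : ∀ {k} {b : Fin k → Carrier} → Independent b →
    ∀ {c c′} → Coefficients c → Coefficients c′ → c · b ≡ c′ · b → ∀ i → c i ≡ c′ i
  independent⇒injective {b = b} indep {c} {c′} c-F c′-F c·b≡c′·b i =
    x∙y⁻¹≈ε⇒x≈y _ _ (indep (λ i → c i + - c′ i) (λ i → F-+ (c-F i) (F-neg (c′-F i)))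
      (trans (sym (·-sub c c′ b)) (trans (cong (_+ - (c′ · b)) c·b≡c′·b) (-‿inverseʳ _))) i)

  span-0 : ∀ {k} (b : Fin k → Carrier) → Span b 0#
  span-0 b = (λ _ → 0#) , (λ _ → F-0) , sym (·-zero b)

  span-+ : ∀ {k} (b : Fin k → Carrier) {x y} → Span b x → Span b y → Span b (x + y)
  span-+ b (c , c-F , x≡) (c′ , c′-F , y≡) =
    (λ i → c i + c′ i) , (λ i → F-+ (c-F i) (c′-F i)) , trans (cong₂ _+_ x≡ y≡) (·-+ c c′ b)

  span-scale : ∀ {k} (b : Fin k → Carrier) {a x} → F a → Span b x → Span b (a * x)
  span-scale b {a} a-F (c , c-F , x≡) =
    (λ i → a * c i) , (λ i → F-* a-F (c-F i)) , trans (cong (a *_) x≡) (·-scaleˡ a c b)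

  δ-F : ∀ {k} (t i : Fin k) → F (δ t i)
  δ-F Fin.zero Fin.zero = F-1
  δ-F Fin.zero (Fin.suc _) = F-0
  δ-F (Fin.suc _) Fin.zero = F-0
  δ-F (Fin.suc t) (Fin.suc i) = δ-F t i

  span-member : ∀ {k} (b : Fin k → Carrier) i → Span b (b i)
  span-member b i = (λ t → δ t i) , (λ t → δ-F t i) , sym (δ-· i b)

  span-· : ∀ {k r} (b : Fin k → Carrier) (c z : Fin r → Carrier) →
           Coefficients c → (∀ i → Span b (z i)) → Span b (c · z)
  span-· {r = zero} b c z _ _ = span-0 b
  span-· {r = suc r} b c z c-F z-span =
    span-+ b (span-scale b (c-F Fin.zero) (z-span Fin.zero))
             (span-· b (c ∘ Fin.suc) (z ∘ Fin.suc) (c-F ∘ Fin.suc) (z-span ∘ Fin.suc))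

  -- An independent family of k vectors spans exactly q ^ k elements: the span is
  -- the injective image of the q ^ k coefficient vectors.
  span-card : ∀ {k} (b : Fin k → Carrier) → Independent b → HasCard (Span b) (q ℕ.^ k)
  span-card {k} b indep =
    HasCard-⇔ image⇔span (HasCard-image combination injective (HasCard-vectors F-card k))
    where
    combination : Vec Carrier k → Carrier
    combination v = lookup v · b
    injective : ∀ {v w} → VecAll.All F v → VecAll.All F w → combination v ≡ combination w → v ≡ w
    injective {v} {w} v-F w-F v≡w =
      trans (sym (tabulate∘lookup v))
            (trans (tabulate-cong (independent⇒injective indep (VecAll.lookup⁺ v-F) (VecAll.lookup⁺ w-F) v≡w))
                   (tabulate∘lookup w))
    image⇔span : ∀ x → (∃[ v ] (VecAll.All F v × x ≡ combination v)) ⇔ Span b x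
    image⇔span x = mk⇔
      (λ (v , v-F , x≡) → lookup v , VecAll.lookup⁺ v-F , x≡)
      (λ (c , c-F , x≡) → tabulate c , VecAll.tabulate⁺ c-F ,
                           trans x≡ (·-congˡ b (sym ∘ lookup∘tabulate c)))

  subspace-· : ∀ {W} → IsSubspace W → ∀ {k} (c b : Fin k → Carrier) →
               Coefficients c → (∀ i → b i ∈K W) → (c · b) ∈K W
  subspace-· W-sub {zero} _ _ _ _ = IsSubspace.has-0 W-sub
  subspace-· W-sub {suc k} c b c-F b∈W =
    IsSubspace.closed-+ W-sub (IsSubspace.closed-scalar W-sub (c-F Fin.zero) (b∈W Fin.zero))
      (subspace-· W-sub (c ∘ Fin.suc) (b ∘ Fin.suc) (c-F ∘ Fin.suc) (b∈W ∘ Fin.suc))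

  -- An m-dimensional subspace has q ^ m elements: it is the span of its basis.
  subspace-card : ∀ {m W} → IsSubspace W → HasDimension m W → HasCard (_∈K W) (q ℕ.^ m)
  subspace-card {W = W} W-sub (b , b∈W , spans , indep) = HasCard-⇔ span⇔member (span-card b indep)
    where
    span⇔member : ∀ x → Span b x ⇔ x ∈K W
    span⇔member x = mk⇔ (λ (c , c-F , x≡) → subst (_∈K W) (sym x≡) (subspace-· W-sub c b c-F b∈W))
                        (spans x)

  Span? : ∀ {k} (b : Fin k → Carrier) x → Dec (Span b x)
  Span? {k} b x = ∃-family? k
    (λ c≗c′ (c-F , x≡) → (λ i → subst F (c≗c′ i) (c-F i)) , trans x≡ (·-congˡ b c≗c′))
    (λ c → Fin.all? (F? ∘ c) ×-dec (x ≟ (c · b)))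

  Dependent? : ∀ {k} (b : Fin k → Carrier) → Dec (Dependent b)
  Dependent? {k} b = ∃-family? k
    (λ c≗c′ (c-F , c·b≡0 , i , cᵢ≢0) →
      (λ j → subst F (c≗c′ j) (c-F j)) , trans (·-congˡ b (sym ∘ c≗c′)) c·b≡0 ,
      i , (λ c′ᵢ≡0 → cᵢ≢0 (trans (c≗c′ i) c′ᵢ≡0)))
    (λ c → Fin.all? (F? ∘ c) ×-dec (((c · b) ≟ 0#) ×-dec Fin.any? (λ i → ¬? (c i ≟ 0#))))

  Independent? : ∀ {k} (b : Fin k → Carrier) → Dec (Independent b)
  Independent? b = map′ (¬dependent⇒independent b)
    (λ indep (c , c-F , c·b≡0 , i , cᵢ≢0) → cᵢ≢0 (indep c c-F c·b≡0 i)) (¬? (Dependent? b))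


first-transition : {P : ℕ → Set} → Decidable P → ∀ a k → ¬ P a → P (a ℕ.+ k) →
                   ∃[ d ] (a ≤ d × ¬ P d × P (suc d))
first-transition {P} P? a zero ¬Pa Pa+0 = ⊥-elim (¬Pa (subst P (ℕ.+-identityʳ a) Pa+0))
first-transition {P} P? a (suc k) ¬Pa Pa+k with P? (suc a)
... | yes P1+a = a , ℕ.≤-refl , ¬Pa , P1+a
... | no ¬P1+a with first-transition P? (suc a) k ¬P1+a (subst P (ℕ.+-suc a k) Pa+k)
...   | d , a<d , ¬Pd , P1+d = d , ℕ.<⇒≤ a<d , ¬Pd , P1+d

data LastOrInject {k : ℕ} : Fin (suc k) → Set where
  last : LastOrInject (fromℕ k)
  inject : (j : Fin k) → LastOrInject (inject₁ j)

lastOrInject : ∀ {k} (i : Fin (suc k)) → LastOrInject i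
lastOrInject {zero} Fin.zero = last
lastOrInject {suc k} Fin.zero = inject Fin.zero
lastOrInject {suc k} (Fin.suc i) with lastOrInject i
... | last = last
... | inject j = inject (Fin.suc j)

module Degree {N : ℕ} (K : FiniteField N) (F : FiniteField.Carrier K → Set)
              (F-subfield : FieldNotions.IsSubfield K F) {q : ℕ} (F-card : HasCard F q)
              (α : FiniteField.Carrier K) (generates : FieldNotions.Generates K F α) where
  open FiniteField K
  open FieldNotions K
  open FieldFacts K
  open Linear K F F-subfield F-card
  open IsSubfield F-subfield
    renaming (has-0 to F-0; has-1 to F-1; closed-+ to F-+; closed-neg to F-neg; closed-* to F-*)
  open Inverse enumeration using (to)
  open ≡-Reasoning

  -- The N + 1 powers 1, α, …, α^N cannot be independent: two of them coincide, α^i = α^j,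
  -- and the relation α^i - α^j = 0 has coefficient 1 at i.
  powers-dependent : Dependent (powers α (suc N))
  powers-dependent with Fin.pigeonhole (ℕ.n<1+n N) (λ i → to (α ^ toℕ i))
  ... | i , j , i<j , αⁱ≡αʲ =
    (λ t → δ t i + - δ t j) , (λ t → F-+ (δ-F t i) (F-neg (δ-F t j))) , relation , i , cᵢ≢0
    where
    relation : (λ t → δ t i + - δ t j) · powers α (suc N) ≡ 0#
    relation = begin
      (λ t → δ t i + - δ t j) · powers α (suc N)
        ≡⟨ ·-sub (λ t → δ t i) (λ t → δ t j) (powers α (suc N)) ⟨
      (λ t → δ t i) · powers α (suc N) + - ((λ t → δ t j) · powers α (suc N))
        ≡⟨ cong₂ (λ x y → x + - y) (δ-· i (powers α (suc N))) (δ-· j (powers α (suc N))) ⟩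
      α ^ toℕ i + - (α ^ toℕ j)
        ≡⟨ cong (λ y → α ^ toℕ i + - y) (to-injective αⁱ≡αʲ) ⟨
      α ^ toℕ i + - (α ^ toℕ i)
        ≡⟨ -‿inverseʳ _ ⟩
      0# ∎
    cᵢ≢0 : ¬ δ i i + - δ i j ≡ 0#
    cᵢ≢0 cᵢ≡0 = 0≢1 (sym (begin
      1#             ≡⟨ +-identityʳ 1# ⟨
      1# + 0#        ≡⟨ cong₂ _+_ (sym (δ-refl i)) (trans (sym -0#≈0#) (cong -_ (sym δᵢⱼ≡0))) ⟩
      δ i i + - δ i j ≡⟨ cᵢ≡0 ⟩
      0#             ∎))
      where
      δᵢⱼ≡0 : δ i j ≡ 0#
      δᵢⱼ≡0 = δ-≢ i j (Fin.<⇒≢ i<j)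

  ·-split-top : ∀ d (c : Fin (suc d) → Carrier) →
                c · powers α (suc d) ≡ (c ∘ inject₁) · powers α d + c (fromℕ d) * α ^ d
  ·-split-top d c = trans (∑-init-last d (λ t → c t * powers α (suc d) t)) (cong₂ _+_
    (∑-cong (λ j → cong (λ e → c (inject₁ j) * α ^ e) (Fin.toℕ-inject₁ j)))
    (cong (λ e → c (fromℕ d) * α ^ e) (Fin.toℕ-fromℕ d)))

  -- If 1, …, α^(d-1) are independent but 1, …, α^d are not, then α^d lies in the
  -- span of the lower powers: the top coefficient of the relation cannot vanish.
  top-in-span : ∀ d → Independent (powers α d) → Dependent (powers α (suc d)) → Span (powers α d) (α ^ d)
  top-in-span d indep (c , c-F , relation , i , cᵢ≢0) with c (fromℕ d) ≟ 0#
  ... | yes top≡0 = ⊥-elim (cᵢ≢0 (vanishes i (lastOrInject i)))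
    where
    lower-relation : (c ∘ inject₁) · powers α d ≡ 0#
    lower-relation = begin
      (c ∘ inject₁) · powers α d                          ≡⟨ +-identityʳ _ ⟨
      (c ∘ inject₁) · powers α d + 0#                     ≡⟨ cong ((c ∘ inject₁) · powers α d +_) top-term≡0 ⟨
      (c ∘ inject₁) · powers α d + c (fromℕ d) * α ^ d    ≡⟨ ·-split-top d c ⟨
      c · powers α (suc d)                                ≡⟨ relation ⟩
      0#                                                  ∎
      where
      top-term≡0 : c (fromℕ d) * α ^ d ≡ 0#
      top-term≡0 = trans (cong (_* α ^ d) top≡0) (zeroˡ _)
    vanishes : ∀ i → LastOrInject i → c i ≡ 0#
    vanishes _ last = top≡0
    vanishes _ (inject j) = indep (c ∘ inject₁) (c-F ∘ inject₁) lower-relation j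
  ... | no top≢0 with inverse _ top≢0
  ... | e , top·e≡1 =
    (λ j → - e * c (inject₁ j)) , (λ j → F-* (F-neg e-F) (c-F (inject₁ j))) , (begin
      α ^ d                                  ≡⟨ *-identityˡ _ ⟨
      1# * α ^ d                             ≡⟨ cong (_* α ^ d) (trans (sym top·e≡1) (*-comm _ e)) ⟩
      (e * c (fromℕ d)) * α ^ d              ≡⟨ *-assoc e _ _ ⟩
      e * (c (fromℕ d) * α ^ d)              ≡⟨ cong (e *_) (+-inverseʳ-unique _ _ (trans (sym (·-split-top d c)) relation)) ⟩
      e * - ((c ∘ inject₁) · powers α d)     ≡⟨ trans (sym (-‿distribʳ-* e _)) (-‿distribˡ-* e _) ⟩
      - e * ((c ∘ inject₁) · powers α d)     ≡⟨ ·-scaleˡ (- e) (c ∘ inject₁) (powers α d) ⟩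
      (λ j → - e * c (inject₁ j)) · powers α d ∎)
    where
    e-F : F e
    e-F = IsSubfield.closed-inv F-subfield (c-F (fromℕ d)) top·e≡1

  -- When α^d lies in the span S of 1, …, α^(d-1), S is closed under multiplication by α,
  -- hence under products; inverses are powers, so S is a subfield containing F and α,
  -- which is all of K.  (Stated for d = suc d, as S must contain 1.)
  module PowerSpan (d : ℕ) (top : Span (powers α (suc d)) (α ^ suc d)) where
    S : Carrier → Set
    S = Span (powers α (suc d))

    α-closed : ∀ {x} → S x → S (α * x)
    α-closed {x} (c , c-F , x≡) =
      subst S (sym (trans (cong (α *_) x≡) (·-scaleʳ α c (powers α (suc d)))))
        (span-· (powers α (suc d)) c (λ i → α ^ suc (toℕ i)) c-F next-power)
      where
      next-power : ∀ i → S (α ^ suc (toℕ i))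
      next-power i with lastOrInject i
      ... | last = subst (λ e → S (α ^ suc e)) (sym (Fin.toℕ-fromℕ d)) top
      ... | inject j = subst (λ e → S (α ^ suc e)) (sym (Fin.toℕ-inject₁ j))
                             (span-member (powers α (suc d)) (Fin.suc j))

    power-closed : ∀ k {x} → S x → S (α ^ k * x)
    power-closed zero Sx = subst S (sym (*-identityˡ _)) Sx
    power-closed (suc k) Sx = subst S (sym (*-assoc α _ _)) (α-closed (power-closed k Sx))

    *-closed : ∀ {x y} → S x → S y → S (x * y)
    *-closed {x} {y} (c , c-F , x≡) Sy =
      subst S (sym x·y≡) (span-· (powers α (suc d)) c (λ i → powers α (suc d) i * y) c-F
                                 (λ i → power-closed (toℕ i) Sy))
      where
      x·y≡ : x * y ≡ c · (λ i → powers α (suc d) i * y)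
      x·y≡ = begin
        x * y                                   ≡⟨ *-comm x y ⟩
        y * x                                   ≡⟨ cong (y *_) x≡ ⟩
        y * (c · powers α (suc d))              ≡⟨ ·-scaleʳ y c (powers α (suc d)) ⟩
        c · (λ i → y * powers α (suc d) i)      ≡⟨ ·-congʳ c (λ i → *-comm y (powers α (suc d) i)) ⟩
        c · (λ i → powers α (suc d) i * y)      ∎

    one : S 1#
    one = span-member (powers α (suc d)) Fin.zero

    ^-closed : ∀ {x} → S x → ∀ k → S (x ^ k)
    ^-closed Sx zero = one
    ^-closed Sx (suc k) = *-closed Sx (^-closed Sx k)

    subfield : IsSubfield S
    subfield = record
      { has-0 = span-0 (powers α (suc d))
      ; has-1 = one
      ; closed-+ = span-+ (powers α (suc d))
      ; closed-neg = λ {x} Sx → subst S (-1*x≈-x x) (span-scale (powers α (suc d)) (F-neg F-1) Sx)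
      ; closed-* = *-closed
      ; closed-inv = λ Sx x·y≡1 → let (e , y≡xᵉ) = inverse-is-power x·y≡1 in
                                  subst S (sym y≡xᵉ) (^-closed Sx e)
      }

    spans-K : ∀ x → S x
    spans-K = generates S subfield
      (λ c F-c → subst S (*-identityʳ c) (span-scale (powers α (suc d)) F-c one))
      (subst S (*-identityʳ α) (α-closed one))

  powers-1-independent : ¬ Dependent (powers α 1)
  powers-1-independent (c , _ , c·1≡0 , Fin.zero , c₀≢0) =
    c₀≢0 (trans (sym (*-identityʳ _)) (trans (sym (+-identityʳ _)) c·1≡0))

  power-basis : ∃[ d ] (Independent (powers α d) × (∀ x → Span (powers α d) x) × q ℕ.^ d ≡ N)
  power-basis with first-transition (Dependent? ∘ powers α) 1 N powers-1-independent powers-dependent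
  ... | suc d , _ , ¬dependent , dependent =
    suc d , independent , spans , card-unique (span-card (powers α (suc d)) independent) elements
                                              (λ x → mk⇔ (λ _ → tt) (λ _ → spans x))
    where
    independent : Independent (powers α (suc d))
    independent = ¬dependent⇒independent (powers α (suc d)) ¬dependent
    spans : ∀ x → Span (powers α (suc d)) x
    spans = PowerSpan.spans-K d (top-in-span (suc d) independent dependent)


-- The splitting subspace W₀ = span{1, αⁿ, α²ⁿ, …, α^((m-1)n)}, given that
-- 1, α, …, α^(mn-1) is an F-basis of K (here m = m′ + 1, n = n′ + 1).  Writing
-- exponents t < mn as t = nj + i with i < n, j < m, every x ∈ K is uniquely
-- Σᵢ αⁱ wᵢ with wᵢ ∈ W₀.
module StandardSplitting {N : ℕ} (K : FiniteField N) (F : FiniteField.Carrier K → Set)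
         (F-subfield : FieldNotions.IsSubfield K F) {q : ℕ} (F-card : HasCard F q)
         (α : FiniteField.Carrier K) (m′ n′ : ℕ)
         (basis-independent : Linear.Independent K F F-subfield F-card
                                (FieldFacts.powers K α (suc m′ ℕ.* suc n′)))
         (basis-spans : ∀ x → Linear.Span K F F-subfield F-card
                                (FieldFacts.powers K α (suc m′ ℕ.* suc n′)) x) where
  open FiniteField K
  open FieldNotions K
  open OverSubfield F
  open FieldFacts K
  open Decide K
  open Linear K F F-subfield F-card
  open IsSubfield F-subfield using () renaming (has-0 to F-0; closed-+ to F-+; closed-neg to F-neg)
  open ≡-Reasoning

  m n : ℕ
  m = suc m′
  n = suc n′

  b₀ : Fin m → Carrier
  b₀ j = α ^ (n ℕ.* toℕ j)

  -- The coefficient family on Fin (mn) whose entry at t = nj + i is e i j.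
  expand : (Fin n → Fin m → Carrier) → Fin (m ℕ.* n) → Carrier
  expand e t = e (remainder {m} n t) (quotient {m} n t)

  expand-combine : ∀ e j i → expand e (combine j i) ≡ e i j
  expand-combine e j i = cong (λ (j′ , i′) → e i′ j′) (Fin.remQuot-combine j i)

  expand-F : ∀ {e} → (∀ i j → F (e i j)) → Coefficients (expand e)
  expand-F e-F t = e-F (remainder {m} n t) (quotient {m} n t)

  expand-vanishes : ∀ {e} → (∀ i j → F (e i j)) → expand e · powers α (m ℕ.* n) ≡ 0# → ∀ i j → e i j ≡ 0#
  expand-vanishes {e} e-F relation i j =
    trans (sym (expand-combine e j i)) (basis-independent (expand e) (expand-F e-F) relation (combine j i))

  regroup : ∀ (e : Fin n → Fin m → Carrier) →
            expand e · powers α (m ℕ.* n) ≡ powers α n · (λ i → e i · b₀)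
  regroup e = begin
    expand e · powers α (m ℕ.* n)
      ≡⟨ ∑-combine m {n} (λ t → expand e t * powers α (m ℕ.* n) t) ⟩
    ∑ m (λ j → ∑ n (λ i → expand e (combine j i) * α ^ toℕ (combine j i)))
      ≡⟨ ∑-cong (λ j → ∑-cong (λ i → term j i)) ⟩
    ∑ m (λ j → ∑ n (λ i → α ^ toℕ i * (e i j * b₀ j)))
      ≡⟨ ∑-swap (λ j i → α ^ toℕ i * (e i j * b₀ j)) ⟩
    ∑ n (λ i → ∑ m (λ j → α ^ toℕ i * (e i j * b₀ j)))
      ≡⟨ ∑-cong (λ i → ∑-distribˡ-* (α ^ toℕ i) (λ j → e i j * b₀ j)) ⟨
    powers α n · (λ i → e i · b₀) ∎
    where
    term : ∀ j i → expand e (combine j i) * α ^ toℕ (combine j i) ≡ α ^ toℕ i * (e i j * b₀ j)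
    term j i = begin
      expand e (combine j i) * α ^ toℕ (combine j i)
        ≡⟨ cong₂ (λ c t → c * α ^ t) (expand-combine e j i) (Fin.toℕ-combine j i) ⟩
      e i j * α ^ (n ℕ.* toℕ j ℕ.+ toℕ i)             ≡⟨ cong (e i j *_) (^-+ α (n ℕ.* toℕ j) (toℕ i)) ⟩
      e i j * (b₀ j * α ^ toℕ i)                      ≡⟨ cong (e i j *_) (*-comm (b₀ j) _) ⟩
      e i j * (α ^ toℕ i * b₀ j)                      ≡⟨ *-exchange (e i j) _ _ ⟩
      α ^ toℕ i * (e i j * b₀ j)                      ∎

  W₀ : Subset N
  W₀ = ⟦ Span? b₀ ⟧

  W₀-member : ∀ {x} → Span b₀ x → x ∈K W₀
  W₀-member {x} = Equivalence.from (∈⟦⟧ (Span? b₀) x)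

  W₀-span : ∀ {x} → x ∈K W₀ → Span b₀ x
  W₀-span {x} = Equivalence.to (∈⟦⟧ (Span? b₀) x)

  W₀-subspace : IsSubspace W₀
  W₀-subspace = record
    { has-0 = W₀-member (span-0 b₀)
    ; closed-+ = λ x∈ y∈ → W₀-member (span-+ b₀ (W₀-span x∈) (W₀-span y∈))
    ; closed-scalar = λ c-F x∈ → W₀-member (span-scale b₀ c-F (W₀-span x∈))
    }

  -- b₀ is independent: a relation Σⱼ cⱼ α^(nj) = 0 is a relation among the powers
  -- α^t with coefficients c at t = nj and 0 elsewhere.
  b₀-independent : Independent b₀
  b₀-independent c c-F c·b₀≡0 j = expand-vanishes e-F expansion≡0 Fin.zero j
    where
    e : Fin n → Fin m → Carrier
    e Fin.zero = c
    e (Fin.suc _) = λ _ → 0#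
    e-F : ∀ i j → F (e i j)
    e-F Fin.zero = c-F
    e-F (Fin.suc _) _ = F-0
    expansion≡0 : expand e · powers α (m ℕ.* n) ≡ 0#
    expansion≡0 = begin
      expand e · powers α (m ℕ.* n)                                 ≡⟨ regroup e ⟩
      1# * (c · b₀) + ∑ n′ (λ i → α ^ suc (toℕ i) * ((λ _ → 0#) · b₀))
        ≡⟨ cong₂ _+_ (trans (*-identityˡ _) c·b₀≡0) (trans (∑-cong {n′} higher-terms) (∑-zero n′)) ⟩
      0# + 0#                                                       ≡⟨ +-identityʳ 0# ⟩
      0#                                                            ∎
      where
      higher-terms : ∀ i → α ^ suc (toℕ i) * ((λ _ → 0#) · b₀) ≡ 0#
      higher-terms i = trans (cong (α ^ suc (toℕ i) *_) (·-zero b₀)) (zeroʳ _)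

  W₀-dimension : HasDimension m W₀
  W₀-dimension = b₀ , (λ j → W₀-member (span-member b₀ j)) , (λ _ → W₀-span) , b₀-independent

  -- Every x is Σᵢ αⁱ wᵢ with wᵢ = Σⱼ c_{nj+i} α^(nj) ∈ W₀, where x = Σ_t c_t α^t.
  W₀-decomposition : ∀ x → Σ[ w ∈ (Fin n → Carrier) ] ((∀ i → w i ∈K W₀) × x ≡ powers α n · w)
  W₀-decomposition x with basis-spans x
  ... | c , c-F , x≡ = (λ i → e i · b₀) , (λ i → W₀-member (e i , (λ j → c-F _) , refl)) , (begin
    x                               ≡⟨ x≡ ⟩
    c · powers α (m ℕ.* n)          ≡⟨ ∑-cong (λ t → cong (λ s → c s * α ^ toℕ t) (Fin.combine-remQuot {m} n t)) ⟨
    expand e · powers α (m ℕ.* n)   ≡⟨ regroup e ⟩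
    powers α n · (λ i → e i · b₀)   ∎)
    where
    e : Fin n → Fin m → Carrier
    e i j = c (combine j i)

  -- The decomposition is unique: the difference of two decompositions expands to
  -- a relation among the powers α^t, whose coefficients must all vanish.
  W₀-unique : ∀ (w w′ : Fin n → Carrier) → (∀ i → w i ∈K W₀) → (∀ i → w′ i ∈K W₀) →
              powers α n · w ≡ powers α n · w′ → ∀ i → w i ≡ w′ i
  W₀-unique w w′ w∈ w′∈ same-sum i = begin
    w i                 ≡⟨ w≡ i ⟩
    a i · b₀            ≡⟨ ·-congˡ b₀ (λ j → x∙y⁻¹≈ε⇒x≈y _ _ (expand-vanishes d-F expansion≡0 i j)) ⟩
    a′ i · b₀           ≡⟨ w′≡ i ⟨
    w′ i                ∎
    where
    a a′ : Fin n → Fin m → Carrier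
    a i = proj₁ (W₀-span (w∈ i))
    a′ i = proj₁ (W₀-span (w′∈ i))
    d : Fin n → Fin m → Carrier
    d i j = a i j + - a′ i j
    w≡ : ∀ i → w i ≡ a i · b₀
    w≡ i = proj₂ (proj₂ (W₀-span (w∈ i)))
    w′≡ : ∀ i → w′ i ≡ a′ i · b₀
    w′≡ i = proj₂ (proj₂ (W₀-span (w′∈ i)))
    d-F : ∀ i j → F (d i j)
    d-F i j = F-+ (proj₁ (proj₂ (W₀-span (w∈ i))) j) (F-neg (proj₁ (proj₂ (W₀-span (w′∈ i))) j))
    expansion≡0 : expand d · powers α (m ℕ.* n) ≡ 0#
    expansion≡0 = begin
      expand d · powers α (m ℕ.* n)                      ≡⟨ regroup d ⟩
      powers α n · (λ i → d i · b₀)                      ≡⟨ ·-congʳ (powers α n) (λ i → sym (·-sub (a i) (a′ i) b₀)) ⟩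
      powers α n · (λ i → a i · b₀ + - (a′ i · b₀))      ≡⟨ ·-congʳ (powers α n) (λ i → cong₂ (λ u v → u + - v) (w≡ i) (w′≡ i)) ⟨
      powers α n · (λ i → w i + - w′ i)                  ≡⟨ ·-subʳ (powers α n) w w′ ⟨
      powers α n · w + - (powers α n · w′)               ≡⟨ cong (_+ - (powers α n · w′)) same-sum ⟩
      powers α n · w′ + - (powers α n · w′)              ≡⟨ -‿inverseʳ _ ⟩
      0#                                                 ∎

  W₀-splitting : IsSplittingSubspace m n α W₀
  W₀-splitting = W₀-subspace , W₀-dimension , W₀-decomposition , W₀-unique

  one∈W₀ : 1# ∈K W₀
  one∈W₀ = subst (_∈K W₀) (cong (α ^_) (ℕ.*-zeroʳ n)) (W₀-member (span-member b₀ Fin.zero))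

-- Multiplying by a nonzero β preserves m-dimensional σ-splitting subspaces, since
-- x ↦ βx is an F-linear automorphism of K commuting with multiplication by σ.
module Scaling {N : ℕ} (K : FiniteField N) (F : FiniteField.Carrier K → Set) (m n : ℕ)
               (σ : FiniteField.Carrier K) where
  open FiniteField K
  open FieldNotions K
  open OverSubfield F
  open FieldFacts K
  open Decide K
  open ≡-Reasoning

  module Scaled (W : Subset N) (β : Carrier) (β≢0 : ¬ β ≡ 0#) (βW : Subset N)
                (βW⇔ : ∀ y → y ∈K βW ⇔ (∃[ w ] (w ∈K W × y ≡ β * w))) where
    ∈βW : ∀ {w y} → w ∈K W → y ≡ β * w → y ∈K βW
    ∈βW {w} {y} w∈W y≡βw = Equivalence.from (βW⇔ y) (w , w∈W , y≡βw)

    ∈W : ∀ {y} → y ∈K βW → ∃[ w ] (w ∈K W × y ≡ β * w)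
    ∈W {y} = Equivalence.to (βW⇔ y)

    subspace : IsSubspace W → IsSubspace βW
    subspace W-sub = record
      { has-0 = ∈βW (IsSubspace.has-0 W-sub) (sym (zeroʳ β))
      ; closed-+ = λ x∈ y∈ → let (w , w∈ , x≡) = ∈W x∈ ; (w′ , w′∈ , y≡) = ∈W y∈ in
          ∈βW (IsSubspace.closed-+ W-sub w∈ w′∈) (trans (cong₂ _+_ x≡ y≡) (sym (distribˡ β w w′)))
      ; closed-scalar = λ {c} c-F x∈ → let (w , w∈ , x≡) = ∈W x∈ in
          ∈βW (IsSubspace.closed-scalar W-sub c-F w∈) (trans (cong (c *_) x≡) (*-exchange c β w))
      }

    dimension : HasDimension m W → HasDimension m βW
    dimension (b , b∈W , b-spans , b-indep) = (λ i → β * b i) , (λ i → ∈βW (b∈W i) refl) , βb-spans , βb-indep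
      where
      βb-spans : ∀ y → y ∈K βW → Σ[ c ∈ (Fin m → Carrier) ] ((∀ i → F (c i)) × y ≡ c · (λ i → β * b i))
      βb-spans y y∈ with ∈W y∈
      ... | w , w∈ , y≡ with b-spans w w∈
      ...   | c , c-F , w≡ = c , c-F , trans y≡ (trans (cong (β *_) w≡) (·-scaleʳ β c b))
      βb-indep : ∀ c → (∀ i → F (c i)) → c · (λ i → β * b i) ≡ 0# → ∀ i → c i ≡ 0#
      βb-indep c c-F c·βb≡0 = b-indep c c-F
        (*-cancelˡ _ _ β≢0 (trans (trans (·-scaleʳ β c b) c·βb≡0) (sym (zeroʳ β))))

    -- x = Σᵢ σⁱ (β wᵢ) where β⁻¹x = Σᵢ σⁱ wᵢ.
    decompositions : (∀ x → Σ[ w ∈ (Fin n → Carrier) ] ((∀ i → w i ∈K W) × x ≡ powers σ n · w)) →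
                     ∀ x → Σ[ u ∈ (Fin n → Carrier) ] ((∀ i → u i ∈K βW) × x ≡ powers σ n · u)
    decompositions decompose x with inverse β β≢0
    ... | β⁻¹ , ββ⁻¹≡1 with decompose (β⁻¹ * x)
    ...   | w , w∈ , β⁻¹x≡ = (λ i → β * w i) , (λ i → ∈βW (w∈ i) refl) , (begin
      x                            ≡⟨ inverse-cancel ββ⁻¹≡1 x ⟨
      β * (β⁻¹ * x)                ≡⟨ cong (β *_) β⁻¹x≡ ⟩
      β * (powers σ n · w)         ≡⟨ ·-scaleʳ β (powers σ n) w ⟩
      powers σ n · (λ i → β * w i) ∎)

    -- Two decompositions Σᵢ σⁱ (β vᵢ) = Σᵢ σⁱ (β v′ᵢ) give, after cancelling β,
    -- two decompositions over W.
    uniqueness : (∀ (w w′ : Fin n → Carrier) → (∀ i → w i ∈K W) → (∀ i → w′ i ∈K W) →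
                   powers σ n · w ≡ powers σ n · w′ → ∀ i → w i ≡ w′ i) →
                 ∀ (u u′ : Fin n → Carrier) → (∀ i → u i ∈K βW) → (∀ i → u′ i ∈K βW) →
                 powers σ n · u ≡ powers σ n · u′ → ∀ i → u i ≡ u′ i
    uniqueness unique u u′ u∈ u′∈ same-sum i = begin
      u i         ≡⟨ u≡βv i ⟩
      β * v i     ≡⟨ cong (β *_) (unique v v′ v∈ v′∈ (*-cancelˡ _ _ β≢0 same-v-sum) i) ⟩
      β * v′ i    ≡⟨ u′≡βv′ i ⟨
      u′ i        ∎
      where
      v v′ : Fin n → Carrier
      v i = proj₁ (∈W (u∈ i))
      v′ i = proj₁ (∈W (u′∈ i))
      v∈ : ∀ i → v i ∈K W
      v∈ i = proj₁ (proj₂ (∈W (u∈ i)))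
      v′∈ : ∀ i → v′ i ∈K W
      v′∈ i = proj₁ (proj₂ (∈W (u′∈ i)))
      u≡βv : ∀ i → u i ≡ β * v i
      u≡βv i = proj₂ (proj₂ (∈W (u∈ i)))
      u′≡βv′ : ∀ i → u′ i ≡ β * v′ i
      u′≡βv′ i = proj₂ (proj₂ (∈W (u′∈ i)))
      same-v-sum : β * (powers σ n · v) ≡ β * (powers σ n · v′)
      same-v-sum = begin
        β * (powers σ n · v)          ≡⟨ ·-scaleʳ β (powers σ n) v ⟩
        powers σ n · (λ i → β * v i)  ≡⟨ ·-congʳ (powers σ n) (sym ∘ u≡βv) ⟩
        powers σ n · u                ≡⟨ same-sum ⟩
        powers σ n · u′               ≡⟨ ·-congʳ (powers σ n) u′≡βv′ ⟩
        powers σ n · (λ i → β * v′ i) ≡⟨ ·-scaleʳ β (powers σ n) v′ ⟨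
        β * (powers σ n · v′)         ∎

  scale-splitting : ∀ W β → IsSplittingSubspace m n σ W → ¬ β ≡ 0# → ∀ (βW : Subset N) →
                    (∀ y → y ∈K βW ⇔ (∃[ w ] (w ∈K W × y ≡ β * w))) →
                    IsSplittingSubspace m n σ βW
  scale-splitting W β (W-sub , W-dim , decompose , unique) β≢0 βW βW⇔ =
    subspace W-sub , dimension W-dim , decompositions decompose , uniqueness unique
    where open Scaled W β β≢0 βW βW⇔

  -- The subset {y | b y ∈ W}; it is b⁻¹W when b is invertible.
  preimage : Carrier → Subset N → Subset N
  preimage b W = ⟦ (λ y → (b * y) ∈K? W) ⟧

  ∈-preimage : ∀ b W y → y ∈K preimage b W ⇔ (b * y) ∈K W
  ∈-preimage b W = ∈⟦⟧ (λ y → (b * y) ∈K? W)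

  preimage-is-scaling : ∀ {β β′} W → β * β′ ≡ 1# →
                        ∀ y → y ∈K preimage β′ W ⇔ (∃[ w ] (w ∈K W × y ≡ β * w))
  preimage-is-scaling {β} {β′} W ββ′≡1 y = mk⇔
    (λ y∈ → β′ * y , Equivalence.to (∈-preimage β′ W y) y∈ , sym (inverse-cancel ββ′≡1 y))
    (λ (w , w∈ , y≡βw) → Equivalence.from (∈-preimage β′ W y)
      (subst (_∈K W) (sym (trans (cong (β′ *_) y≡βw) (inverse-cancel β′β≡1 w))) w∈))
    where
    β′β≡1 : β′ * β ≡ 1#
    β′β≡1 = trans (*-comm β′ β) ββ′≡1

  preimage-inverse : ∀ {b b′} W → b * b′ ≡ 1# → preimage b′ (preimage b W) ≡ W
  preimage-inverse {b} {b′} W bb′≡1 = subset-ext λ y → mk⇔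
    (λ y∈ → subst (_∈K W) (inverse-cancel bb′≡1 y)
              (Equivalence.to (∈-preimage b W _) (Equivalence.to (∈-preimage b′ _ y) y∈)))
    (λ y∈ → Equivalence.from (∈-preimage b′ _ y)
              (Equivalence.from (∈-preimage b W _) (subst (_∈K W) (sym (inverse-cancel bb′≡1 y)) y∈)))

  preimage-through : ∀ {γ γ′ x y W} → γ * γ′ ≡ 1# → γ * y ≡ x →
                     IsSplittingSubspaceThrough m n σ x W →
                     IsSplittingSubspaceThrough m n σ y (preimage γ W)
  preimage-through {γ} {γ′} {x} {y} {W} γγ′≡1 γy≡x (W-splitting , x∈W) =
    scale-splitting W γ′ W-splitting (invertible⇒≢0 (trans (*-comm γ′ γ) γγ′≡1)) (preimage γ W)
                    (preimage-is-scaling W (trans (*-comm γ′ γ) γγ′≡1)) ,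
    Equivalence.from (∈-preimage γ W y) (subst (_∈K W) (sym γy≡x) x∈W)

  -- |𝔖^x| = |𝔖^y| for nonzero x, y: with γ = x y⁻¹, W ↦ γ⁻¹W is a bijection 𝔖^x → 𝔖^y,
  -- inverted by V ↦ γV.
  through-card : ∀ {x y k} → ¬ x ≡ 0# → ¬ y ≡ 0# →
                 HasCard (IsSplittingSubspaceThrough m n σ x) k →
                 HasCard (IsSplittingSubspaceThrough m n σ y) k
  through-card {x} {y} x≢0 y≢0 through-x with inverse x x≢0 | inverse y y≢0
  ... | x⁻¹ , xx⁻¹≡1 | y⁻¹ , yy⁻¹≡1 =
    HasCard-⇔ image⇔through (HasCard-image (preimage γ) injective through-x)
    where
    γ γ′ : Carrier
    γ = x * y⁻¹
    γ′ = y * x⁻¹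
    unit-product : ∀ {a b a⁻¹ b⁻¹} → a * a⁻¹ ≡ 1# → b * b⁻¹ ≡ 1# → (a * b⁻¹) * (b * a⁻¹) ≡ 1#
    unit-product {a} {b} {a⁻¹} {b⁻¹} aa⁻¹≡1 bb⁻¹≡1 = begin
      (a * b⁻¹) * (b * a⁻¹)   ≡⟨ *-assoc a b⁻¹ _ ⟩
      a * (b⁻¹ * (b * a⁻¹))   ≡⟨ cong (a *_) (*-assoc b⁻¹ b a⁻¹) ⟨
      a * ((b⁻¹ * b) * a⁻¹)   ≡⟨ cong (λ z → a * (z * a⁻¹)) (trans (*-comm b⁻¹ b) bb⁻¹≡1) ⟩
      a * (1# * a⁻¹)          ≡⟨ cong (a *_) (*-identityˡ a⁻¹) ⟩
      a * a⁻¹                 ≡⟨ aa⁻¹≡1 ⟩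
      1#                      ∎
    sends : ∀ {a b b⁻¹} → b * b⁻¹ ≡ 1# → (a * b⁻¹) * b ≡ a
    sends {a} {b} {b⁻¹} bb⁻¹≡1 =
      trans (*-assoc a b⁻¹ b) (trans (cong (a *_) (trans (*-comm b⁻¹ b) bb⁻¹≡1)) (*-identityʳ a))
    injective : ∀ {W W′} → IsSplittingSubspaceThrough m n σ x W → IsSplittingSubspaceThrough m n σ x W′ →
                preimage γ W ≡ preimage γ W′ → W ≡ W′
    injective {W} {W′} _ _ same = begin
      W                            ≡⟨ preimage-inverse W (unit-product xx⁻¹≡1 yy⁻¹≡1) ⟨
      preimage γ′ (preimage γ W)   ≡⟨ cong (preimage γ′) same ⟩
      preimage γ′ (preimage γ W′)  ≡⟨ preimage-inverse W′ (unit-product xx⁻¹≡1 yy⁻¹≡1) ⟩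
      W′                           ∎
    image⇔through : ∀ V → (∃[ W ] (IsSplittingSubspaceThrough m n σ x W × V ≡ preimage γ W)) ⇔
                          IsSplittingSubspaceThrough m n σ y V
    image⇔through V = mk⇔
      (λ (W , through-W , V≡) → subst (IsSplittingSubspaceThrough m n σ y) (sym V≡)
                                  (preimage-through (unit-product xx⁻¹≡1 yy⁻¹≡1) (sends yy⁻¹≡1) through-W))
      (λ through-V → preimage γ′ V ,
                     preimage-through (unit-product yy⁻¹≡1 xx⁻¹≡1) (sends xx⁻¹≡1) through-V ,
                     sym (preimage-inverse V (unit-product yy⁻¹≡1 xx⁻¹≡1)))


-- Being an m-dimensional σ-splitting subspace is decidable: every quantifier in the
-- definition ranges over K or over families Fin k → K, all of which are finite.
module DecideSplitting {N : ℕ} (K : FiniteField N) (F : FiniteField.Carrier K → Set)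
         (F-subfield : FieldNotions.IsSubfield K F) {q : ℕ} (F-card : HasCard F q)
         (m n : ℕ) (σ : FiniteField.Carrier K) where
  open FiniteField K
  open FieldNotions K
  open OverSubfield F
  open FieldFacts K
  open Decide K
  open Linear K F F-subfield F-card

  IsSubspace? : ∀ W → Dec (IsSubspace W)
  IsSubspace? W = map′
    (λ (has-0 , closed-+ , closed-scalar) → record
       { has-0 = has-0 ; closed-+ = λ {x} {y} → closed-+ x y ; closed-scalar = λ {c} {x} → closed-scalar c x })
    (λ W-sub → IsSubspace.has-0 W-sub , (λ _ _ → IsSubspace.closed-+ W-sub) ,
               (λ _ _ → IsSubspace.closed-scalar W-sub))
    (0# ∈K? W
      ×-dec ∀? (λ x → ∀? (λ y → (x ∈K? W) →-dec ((y ∈K? W) →-dec ((x + y) ∈K? W))))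
      ×-dec ∀? (λ c → ∀? (λ x → F? c →-dec ((x ∈K? W) →-dec ((c * x) ∈K? W)))))

  HasDimension? : ∀ W → Dec (HasDimension m W)
  HasDimension? W = ∃-family? m transport
    (λ b → Fin.all? (λ i → b i ∈K? W) ×-dec (∀? (λ w → (w ∈K? W) →-dec Span? b w) ×-dec Independent? b))
    where
    transport : Extensional (λ b → (∀ i → b i ∈K W) × (∀ w → w ∈K W → Span b w) × Independent b)
    transport b≗b′ (b∈W , spans , indep) =
      (λ i → subst (_∈K W) (b≗b′ i) (b∈W i)) ,
      (λ w w∈ → let (c , c-F , w≡) = spans w w∈ in c , c-F , trans w≡ (·-congʳ c b≗b′)) ,
      (λ c c-F c·b′≡0 → indep c c-F (trans (·-congʳ c b≗b′) c·b′≡0))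

  IsSplitting? : ∀ W → Dec (IsSplitting n σ W)
  IsSplitting? W = decompositions? ×-dec uniqueness?
    where
    In-W : (Fin n → Carrier) → Set
    In-W w = ∀ i → w i ∈K W
    In-W? : ∀ w → Dec (In-W w)
    In-W? w = Fin.all? (λ i → w i ∈K? W)
    decompositions? : Dec (∀ x → Σ[ w ∈ (Fin n → Carrier) ] (In-W w × x ≡ powers σ n · w))
    decompositions? = ∀? λ x → ∃-family? n
      (λ w≗v (w∈ , x≡) → (λ i → subst (_∈K W) (w≗v i) (w∈ i)) , trans x≡ (·-congʳ (powers σ n) w≗v))
      (λ w → In-W? w ×-dec (x ≟ (powers σ n · w)))
    Unique-from : (Fin n → Carrier) → (Fin n → Carrier) → Set
    Unique-from w w′ = In-W w → In-W w′ → powers σ n · w ≡ powers σ n · w′ → ∀ i → w i ≡ w′ i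
    uniqueness? : Dec (∀ w w′ → Unique-from w w′)
    uniqueness? = ∀-family? n
      (λ w≗v unique-w w′ v∈ w′∈ v≡w′ i →
        trans (sym (w≗v i)) (unique-w w′ (λ j → subst (_∈K W) (sym (w≗v j)) (v∈ j)) w′∈
                                        (trans (·-congʳ (powers σ n) w≗v) v≡w′) i))
      (λ w → ∀-family? n
        (λ w′≗v unique-w w∈ v∈ w≡v i →
          trans (unique-w w∈ (λ j → subst (_∈K W) (sym (w′≗v j)) (v∈ j))
                          (trans w≡v (sym (·-congʳ (powers σ n) w′≗v))) i) (w′≗v i))
        (λ w′ → In-W? w →-dec (In-W? w′ →-dec
                 (((powers σ n · w) ≟ (powers σ n · w′)) →-dec Fin.all? (λ i → w i ≟ w′ i)))))

  IsSplittingSubspace? : ∀ W → Dec (IsSplittingSubspace m n σ W)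
  IsSplittingSubspace? W = IsSubspace? W ×-dec (HasDimension? W ×-dec IsSplitting? W)

module Census {N : ℕ} (K : FiniteField N) (F : FiniteField.Carrier K → Set)
         (F-subfield : FieldNotions.IsSubfield K F) {q : ℕ} (F-card : HasCard F q)
         (m n : ℕ) (σ : FiniteField.Carrier K) where
  open FiniteField K
  open FieldNotions K
  open OverSubfield F
  open FieldFacts K
  open Decide K
  open Linear K F F-subfield F-card
  open DecideSplitting K F F-subfield F-card m n σ
  open Scaling K F m n σ

  subsets : HasCard (λ (_ : Subset N) → ⊤) (2 ℕ.^ N)
  subsets = HasCard-⇔ (λ _ → mk⇔ (λ _ → tt) (λ _ → VecAll.universal (λ _ → tt) _))
                      (HasCard-vectors booleans N)
    where
    booleans : HasCard (λ (_ : Bool) → ⊤) 2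
    booleans = true ∷ false ∷ [] , refl , ((λ ()) All.∷ All.[]) AllPairs.∷ (All.[] AllPairs.∷ AllPairs.[]) ,
               λ { true → mk⇔ (λ _ → here refl) (λ _ → tt) ; false → mk⇔ (λ _ → there (here refl)) (λ _ → tt) }

  splitting-card : ∃[ a ] HasCard (IsSplittingSubspace m n σ) a
  splitting-card = _ , HasCard-⇔ (λ _ → mk⇔ proj₂ (tt ,_)) (HasCard-filter subsets IsSplittingSubspace?)

  through-card-exists : ∀ x → ∃[ b ] HasCard (IsSplittingSubspaceThrough m n σ x) b
  through-card-exists x = _ , HasCard-filter (proj₂ splitting-card) (x ∈K?_)

  nonzero-card : HasCard (λ z → ⊤ × ¬ z ≡ 0#) (N ℕ.∸ 1)
  nonzero-card = HasCard-remove _≟_ elements tt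

  -- |𝔖| (q^m - 1) = |𝔖^x| (N - 1): each W ∈ 𝔖 has q^m - 1 nonzero elements, and each
  -- nonzero z lies in |𝔖^z| = |𝔖^x| members of 𝔖.
  census : ∀ {x a b} → ¬ x ≡ 0# → HasCard (IsSplittingSubspace m n σ) a →
           HasCard (IsSplittingSubspaceThrough m n σ x) b → a ℕ.* (q ℕ.^ m ℕ.∸ 1) ≡ b ℕ.* (N ℕ.∸ 1)
  census {x} {a} {b} x≢0 card-𝔖 card-x =
    trans (double-count (λ W z → z ∈K? W) card-𝔖 nonzero-card rows columns) (ℕ.*-comm (N ℕ.∸ 1) b)
    where
    rows : ∀ W → IsSplittingSubspace m n σ W → HasCard (λ z → (⊤ × ¬ z ≡ 0#) × z ∈K W) (q ℕ.^ m ℕ.∸ 1)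
    rows W (W-sub , W-dim , _) =
      HasCard-⇔ (λ z → mk⇔ (λ (z∈ , z≢0) → (tt , z≢0) , z∈) (λ ((_ , z≢0) , z∈) → z∈ , z≢0))
                (HasCard-remove _≟_ (subspace-card W-sub W-dim) (IsSubspace.has-0 W-sub))
    columns : ∀ z → ⊤ × ¬ z ≡ 0# → HasCard (λ W → IsSplittingSubspace m n σ W × z ∈K W) b
    columns z (_ , z≢0) = through-card x≢0 z≢0 card-x

open import Data.Nat using (_*_; _^_; _∸_)
open FiniteField using (Carrier; 0#)
open FieldNotions using (IsSubfield; Generates; _∈K_)
open FieldNotions.OverSubfield using (IsSplittingSubspace; IsSplittingSubspaceThrough)

prime-power>1 : ∀ {q} → IsPrimePower q → 1 ℕ.< q
prime-power>1 (p , suc k , p-prime , _ , refl) =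
  ℕ.<-≤-trans (ℕ.nonTrivial⇒n>1 p {{prime⇒nonTrivial p-prime}})
    (ℕ.≤-trans (ℕ.≤-reflexive (sym (ℕ.*-identityʳ p)))
               (ℕ.*-monoʳ-≤ p (ℕ.m^n>0 p {{prime⇒nonZero p-prime}} k)))

^-injectiveʳ : ∀ {q} → 1 ℕ.< q → ∀ {a b} → q ℕ.^ a ≡ q ℕ.^ b → a ≡ b
^-injectiveʳ {q} 1<q {a} {b} qᵃ≡qᵇ with ℕ.<-cmp a b
... | tri< a<b _ _ = ⊥-elim (ℕ.<-irrefl qᵃ≡qᵇ (ℕ.^-monoʳ-< q 1<q a<b))
... | tri≈ _ a≡b _ = a≡b
... | tri> _ _ b<a = ⊥-elim (ℕ.<-irrefl (sym qᵃ≡qᵇ) (ℕ.^-monoʳ-< q 1<q b<a))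

proposition5p6 : ∀ {q m n : ℕ} → IsPrimePower q → 1 ≤ m → 1 ≤ n →
    (K : FiniteField (q ^ (m * n))) →
    (Fq : Carrier K → Set) → IsSubfield K Fq → HasCard Fq q →
    (α : Carrier K) → Generates K Fq α →
    ((∃[ W ] IsSplittingSubspace K Fq m n α W)
     × (∀ W β → IsSplittingSubspace K Fq m n α W → ¬ (β ≡ 0# K)
          → ∀ (βW : Subset (q ^ (m * n)))
          → (∀ y → _∈K_ K y βW ⇔ (∃[ w ] (_∈K_ K w W × y ≡ FiniteField._*_ K β w)))
          → IsSplittingSubspace K Fq m n α βW))
    × (∀ x → ¬ (x ≡ 0# K) → ∃[ W ] IsSplittingSubspaceThrough K Fq m n α x W)
    × (∀ x y → ¬ (x ≡ 0# K) → ¬ (y ≡ 0# K)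
         → ∃[ k ] (HasCard (IsSplittingSubspaceThrough K Fq m n α x) k
                   × HasCard (IsSplittingSubspaceThrough K Fq m n α y) k))
    × (∀ x → ¬ (x ≡ 0# K)
         → ∃[ a ] ∃[ b ] (HasCard (IsSplittingSubspace K Fq m n α) a
                          × HasCard (IsSplittingSubspaceThrough K Fq m n α x) b
                          × a * (q ^ m ∸ 1) ≡ b * (q ^ (m * n) ∸ 1)))
proposition5p6 {q} {suc m′} {suc n′} q-prime-power (s≤s z≤n) (s≤s z≤n) K F F-subfield F-card α generates =
  ((W₀ , W₀-splitting) , scale-splitting) ,
  (λ x x≢0 → let (x⁻¹ , xx⁻¹≡1) = inverse x x≢0 ; x⁻¹x≡1 = trans (*-comm x⁻¹ x) xx⁻¹≡1 in
     preimage x⁻¹ W₀ , preimage-through x⁻¹x≡1 x⁻¹x≡1 (W₀-splitting , one∈W₀)) ,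
  (λ x y x≢0 y≢0 → let (k , card-x) = through-card-exists x in
     k , card-x , through-card x≢0 y≢0 card-x) ,
  (λ x x≢0 → let (a , card-𝔖) = splitting-card ; (b , card-x) = through-card-exists x in
     a , b , card-𝔖 , card-x , census x≢0 card-𝔖 card-x)
  where
  m n : ℕ
  m = suc m′
  n = suc n′
  open FiniteField K using (inverse)
  open FieldFacts K using (*-comm; powers)
  open Linear K F F-subfield F-card using (Independent; Span)
  open Scaling K F m n α
  open Census K F F-subfield F-card m n α

  -- The powers 1, α, …, α^(mn-1) form an F-basis of K, as |K| = q^(mn).
  mn-basis : Independent (powers α (m * n)) × (∀ x → Span (powers α (m * n)) x)
  mn-basis with Degree.power-basis K F F-subfield F-card α generates
  ... | d , independent , spans , qᵈ≡qᵐⁿ =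
    subst (λ k → Independent (powers α k) × (∀ x → Span (powers α k) x))
          (^-injectiveʳ (prime-power>1 q-prime-power) qᵈ≡qᵐⁿ) (independent , spans)

  open StandardSplitting K F F-subfield F-card α m′ n′ (proj₁ mn-basis) (proj₂ mn-basis)
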